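{- Let $v\in\mathbb Z^4$ be a primitive integer Descartes quadruple with positive coordinate sum, let $W_1W_2\cdots W_n$ be the word produced by iterating $T_I$ on $v$, and let $k\in\{0,\dots,n\}$ be the largest index such that $W_1,\dots,W_k\in\{S_1,S_2,S_3,S_4\}$ (all swaps). Then $T_I^k(v)$, which lies in the orbit of $v$ under the Apollonian group $\langle S_1,S_2,S_3,S_4\rangle$ (the Apollonian packing of $v$), is a root quadruple after reordering its coordinates. That is, $T_I$ moves a quadruple to the root of its packing via swaps before inverting.
   Context: A Descartes quadruple is $y=(y_0,y_1,y_2,y_3)$ with $(y_0+y_1+y_2+y_3)^2-2(y_0^2+y_1^2+y_2^2+y_3^2)=0$; primitive integer means $y\in\mathbb Z^4$, $\gcd=1$. A Descartes quadruple is a root quadruple if, after reordering its coordinates as $(a,b,c,d)$, one has $a\le0\le b\le c\le d$ and $a+b+c\ge d$. Matrices: $S_1=\begin{pmatrix}-1&2&2&2\\0&1&0&0\\0&0&1&0\\0&0&0&1\end{pmatrix}$, $S_2=\begin{pmatrix}1&0&0&0\\2&-1&2&2\\0&0&1&0\\0&0&0&1\end{pmatrix}$, $S_3=\begin{pmatrix}1&0&0&0\\0&1&0&0\\2&2&-1&2\\0&0&0&1\end{pmatrix}$, $S_4=\begin{pmatrix}1&0&0&0\\0&1&0&0\\0&0&1&0\\2&2&2&-1\end{pmatrix}$, $S_1^\perp=\begin{pmatrix}-1&0&0&0\\2&1&0&0\\2&0&1&0\\2&0&0&1\end{pmatrix}$, $S_2^\perp=\begin{pmatrix}1&2&0&0\\0&-1&0&0\\0&2&1&0\\0&2&0&1\end{pmatrix}$,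 $S_3^\perp=\begin{pmatrix}1&0&2&0\\0&1&2&0\\0&0&-1&0\\0&0&2&1\end{pmatrix}$, $S_4^\perp=\begin{pmatrix}1&0&0&2\\0&1&0&2\\0&0&1&2\\0&0&0&-1\end{pmatrix}$. $T_I(a,b,c,d)=M(a,b,c,d)^t$ where $M$ is the first matrix in this list whose condition holds: $S_1$ if $b+c+d<a$; $S_2$ if $a+c+d<b$; $S_3$ if $a+b+d<c$; $S_4$ if $a+b+c<d$; $S_1^\perp$ if $a<0$; $S_2^\perp$ if $b<0$; $S_3^\perp$ if $c<0$; $S_4^\perp$ if $d<0$. The word is defined by $T_I^k(v)^t=W_kT_I^{k-1}(v)^t$ for $k=1,\dots,n$, where $n$ is the first index at which one of the simplest Descartes quadruples $(1,1,0,0),(1,0,1,0),(1,0,0,1),(0,1,1,0),(0,1,0,1),(0,0,1,1)$ is reached. -}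

module Defs where

open import Data.Nat using (ℕ; zero; suc)
open import Data.Nat.GCD using (gcd)
open import Data.Integer using (ℤ; +_; -[1+_]; _+_; _*_; -_; _<_; _≤_; _<?_; ∣_∣)
open import Data.Fin using (Fin; zero; suc)
open import Data.Fin.Permutation using (Permutation′; _⟨$⟩ʳ_)
open import Data.List using (List; []; _∷_; _++_; [_])
open import Data.Maybe using (Maybe; just; nothing)
open import Data.Product using (_×_; _,_; ∃; proj₂)
open import Data.Sum using (_⊎_)
open import Relation.Nullary using (yes; no)
open import Relation.Binary.PropositionalEquality using (_≡_; _≗_)
open import Data.Unit using (⊤)
open import Data.Empty using (⊥)
import Data.Nat

Quad : Set
Quad = Fin 4 → ℤ

quad : ℤ → ℤ → ℤ → ℤ → Quad
quad a b c d zero = a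
quad a b c d (suc zero) = b
quad a b c d (suc (suc zero)) = c
quad a b c d (suc (suc (suc zero))) = d

Mat : Set
Mat = Fin 4 → Fin 4 → ℤ

mat : Quad → Quad → Quad → Quad → Mat
mat r₀ r₁ r₂ r₃ zero = r₀
mat r₀ r₁ r₂ r₃ (suc zero) = r₁
mat r₀ r₁ r₂ r₃ (suc (suc zero)) = r₂
mat r₀ r₁ r₂ r₃ (suc (suc (suc zero))) = r₃

_·_ : Mat → Quad → Quad
(M · v) i = M i zero * v zero + M i (suc zero) * v (suc zero)
          + M i (suc (suc zero)) * v (suc (suc zero))
          + M i (suc (suc (suc zero))) * v (suc (suc (suc zero)))

sumQ : Quad → ℤ
sumQ v = v zero + v (suc zero) + v (suc (suc zero)) + v (suc (suc (suc zero)))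

sq : ℤ → ℤ
sq x = x * x

IsDescartes : Quad → Set
IsDescartes v = sq (sumQ v) ≡ + 2 * (sq (v zero) + sq (v (suc zero))
                                      + sq (v (suc (suc zero))) + sq (v (suc (suc (suc zero)))))

IsPrimitive : Quad → Set
IsPrimitive v = gcd (gcd (gcd ∣ v zero ∣ ∣ v (suc zero) ∣) ∣ v (suc (suc zero)) ∣)
                    ∣ v (suc (suc (suc zero))) ∣ ≡ 1

IsRootOrdered : ℤ → ℤ → ℤ → ℤ → Set
IsRootOrdered a b c d = a ≤ + 0 × + 0 ≤ b × b ≤ c × c ≤ d × d ≤ a + b + c

IsRoot : Quad → Set
IsRoot v = ∃ λ (π : Permutation′ 4) →
  IsRootOrdered (v (π ⟨$⟩ʳ zero)) (v (π ⟨$⟩ʳ suc zero))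
                (v (π ⟨$⟩ʳ suc (suc zero))) (v (π ⟨$⟩ʳ suc (suc (suc zero))))

data Gen : Set where
  S₁ S₂ S₃ S₄ S₁⊥ S₂⊥ S₃⊥ S₄⊥ : Gen

IsSwap : Gen → Set
IsSwap S₁ = ⊤
IsSwap S₂ = ⊤
IsSwap S₃ = ⊤
IsSwap S₄ = ⊤
IsSwap _ = ⊥

private
  p0 p1 p2 m1 : ℤ
  p0 = + 0
  p1 = + 1
  p2 = + 2
  m1 = -[1+ 0 ]

matrix : Gen → Mat
matrix S₁ = mat (quad m1 p2 p2 p2) (quad p0 p1 p0 p0) (quad p0 p0 p1 p0) (quad p0 p0 p0 p1)
matrix S₂ = mat (quad p1 p0 p0 p0) (quad p2 m1 p2 p2) (quad p0 p0 p1 p0) (quad p0 p0 p0 p1)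
matrix S₃ = mat (quad p1 p0 p0 p0) (quad p0 p1 p0 p0) (quad p2 p2 m1 p2) (quad p0 p0 p0 p1)
matrix S₄ = mat (quad p1 p0 p0 p0) (quad p0 p1 p0 p0) (quad p0 p0 p1 p0) (quad p2 p2 p2 m1)
matrix S₁⊥ = mat (quad m1 p0 p0 p0) (quad p2 p1 p0 p0) (quad p2 p0 p1 p0) (quad p2 p0 p0 p1)
matrix S₂⊥ = mat (quad p1 p2 p0 p0) (quad p0 m1 p0 p0) (quad p0 p2 p1 p0) (quad p0 p2 p0 p1)
matrix S₃⊥ = mat (quad p1 p0 p2 p0) (quad p0 p1 p2 p0) (quad p0 p0 m1 p0) (quad p0 p0 p2 p1)
matrix S₄⊥ = mat (quad p1 p0 p0 p2) (quad p0 p1 p0 p2) (quad p0 p0 p1 p2) (quad p0 p0 p0 m1)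

choose : ℤ → ℤ → ℤ → ℤ → Maybe Gen
choose a b c d with b + c + d <? a
... | yes _ = just S₁
... | no _ with a + c + d <? b
... | yes _ = just S₂
... | no _ with a + b + d <? c
... | yes _ = just S₃
... | no _ with a + b + c <? d
... | yes _ = just S₄
... | no _ with a <? + 0
... | yes _ = just S₁⊥
... | no _ with b <? + 0
... | yes _ = just S₂⊥
... | no _ with c <? + 0
... | yes _ = just S₃⊥
... | no _ with d <? + 0
... | yes _ = just S₄⊥
... | no _ = nothing

-- One step of T_I: the matrix used and T_I(v) = M v (i.e. (M vᵗ)ᵗ). Undefined (nothing)
-- when no condition holds.
TI-step : Quad → Maybe (Gen × Quad)
TI-step v with choose (v zero) (v (suc zero)) (v (suc (suc zero))) (v (suc (suc (suc zero))))
... | just g = just (g , matrix g · v)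
... | nothing = nothing

run : ℕ → Quad → Maybe (List Gen × Quad)
run zero v = just ([] , v)
run (suc k) v with run k v
... | nothing = nothing
... | just (ws , q) with TI-step q
...   | nothing = nothing
...   | just (g , q′) = just (ws ++ [ g ] , q′)

IsSimplest : Quad → Set
IsSimplest v = (v ≗ quad (+ 1) (+ 1) (+ 0) (+ 0)) ⊎ (v ≗ quad (+ 1) (+ 0) (+ 1) (+ 0))
             ⊎ (v ≗ quad (+ 1) (+ 0) (+ 0) (+ 1)) ⊎ (v ≗ quad (+ 0) (+ 1) (+ 1) (+ 0))
             ⊎ (v ≗ quad (+ 0) (+ 1) (+ 0) (+ 1)) ⊎ (v ≗ quad (+ 0) (+ 0) (+ 1) (+ 1))

IsWord : Quad → ℕ → List Gen → Set
IsWord v n W = ∃ λ q → run n v ≡ just (W , q) × IsSimplest q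
             × (∀ m (q′ : Quad) (ws : List Gen) → m Data.Nat.< n → run m v ≡ just (ws , q′) → IsSimplest q′ → ⊥)

-- T_I applies a swap S_i exactly when coordinate i exceeds the sum of the
-- other three. So at the first step that is not a swap (or, if there is none, at the
-- final simplest quadruple) the current quadruple is balanced: every coordinate is at
-- most the sum of the other three; and it has a non-positive coordinate, since T_I
-- inverts only at a negative one. A balanced quadruple with a non-positive coordinate a
-- is a root: order the other three as b ≤ c ≤ d; then d ≤ a + b + c, and b < 0 would
-- force both c < d and d < c.
module Submission where

open import Defs
open import Data.Nat using (ℕ)
open import Data.Integer using (_<_; +_)
open import Data.List using (List; []; _∷_; _++_; length)
open import Data.List.Relation.Unary.All using (All)
open import Data.Product using (_×_; _,_; ∃)
open import Data.Sum using (_⊎_)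
open import Data.Maybe using (just)
open import Relation.Nullary using (¬_)
open import Relation.Binary.PropositionalEquality using (_≡_)

open import Data.Nat as ℕ using (zero; suc)
open import Data.Nat.Properties using (+-comm; suc-injective)
open import Data.Integer using (ℤ; _+_; _-_; _≤_; _≤?_; _<?_)
open import Data.Integer.Properties
  using ( ≤-total; ≤-refl; ≤-reflexive; ≤-trans; <⇒≤; ≮⇒≥; <-asym; ≤-<-trans
        ; +-mono-≤-<; +-mono-<-≤; +-identityˡ; +-0-commutativeMonoid )
open import Data.Integer.Tactic.RingSolver using (solve-∀)
open import Algebra.Properties.CommutativeMonoid.Sum +-0-commutativeMonoid
  using (sum; sum-permute)
open import Data.Fin using (Fin)
open import Data.Fin.Patterns using (0F; 1F; 2F; 3F)
open import Data.Fin.Properties using (all?)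
open import Data.Fin.Permutation using (Permutation′; _⟨$⟩ʳ_; id; transpose; lift₀; _∘ₚ_)
open import Data.Vec.Functional using (rearrange)
open import Data.List using (_∷ʳ_; [_])
open import Data.List.Properties using (length-++; ++-identityʳ; ++-assoc; ∷-injective)
open import Data.Maybe using (nothing)
open import Data.Sum using (inj₁; inj₂)
open import Data.Unit using (tt)
open import Data.Empty using (⊥-elim)
open import Relation.Nullary using (yes; no)
open import Relation.Nullary.Decidable using (Dec; True; toWitness)
open import Relation.Binary.PropositionalEquality using (refl; sym; trans; cong; subst; _≗_)
open Relation.Binary.PropositionalEquality.≡-Reasoning

Balanced : Quad → Set
Balanced q = ∀ i → q i ≤ sumQ q - q i

balanced? : ∀ q → Dec (Balanced q)
balanced? q = all? (λ i → q i ≤? sumQ q - q i)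

sumQ≡sum : ∀ q → sumQ q ≡ sum q
sumQ≡sum q = reassoc (q 0F) (q 1F) (q 2F) (q 3F)
  where
  reassoc : ∀ a b c d → a + b + c + d ≡ a + (b + (c + (d + + 0)))
  reassoc = solve-∀

sumQ-rearrange : ∀ (σ : Permutation′ 4) q → sumQ (rearrange (σ ⟨$⟩ʳ_) q) ≡ sumQ q
sumQ-rearrange σ q = begin
  sumQ (rearrange (σ ⟨$⟩ʳ_) q) ≡⟨ sumQ≡sum (rearrange (σ ⟨$⟩ʳ_) q) ⟩
  sum (rearrange (σ ⟨$⟩ʳ_) q)  ≡⟨ sum-permute q σ ⟨
  sum q                        ≡⟨ sumQ≡sum q ⟨
  sumQ q                       ∎

balanced-rearrange : ∀ (σ : Permutation′ 4) {q} → Balanced q → Balanced (rearrange (σ ⟨$⟩ʳ_) q)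
balanced-rearrange σ {q} balanced i =
  subst (λ s → q (σ ⟨$⟩ʳ i) ≤ s - q (σ ⟨$⟩ʳ i)) (sym (sumQ-rearrange σ q)) (balanced (σ ⟨$⟩ʳ i))

isRoot-rearrange : ∀ (σ : Permutation′ 4) {q} → IsRoot (rearrange (σ ⟨$⟩ʳ_) q) → IsRoot q
isRoot-rearrange σ (π , ordered) = π ∘ₚ σ , ordered

isRootOrdered-cong : ∀ {a b c d a′ b′ c′ d′} → a ≡ a′ → b ≡ b′ → c ≡ c′ → d ≡ d′ →
                     IsRootOrdered a b c d → IsRootOrdered a′ b′ c′ d′
isRootOrdered-cong refl refl refl refl ordered = ordered

isRoot-≗ : ∀ {q r} → q ≗ r → IsRoot r → IsRoot q
isRoot-≗ q≗r (π , ordered) =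
  π , isRootOrdered-cong (sym (q≗r _)) (sym (q≗r _)) (sym (q≗r _)) (sym (q≗r _)) ordered

sort3 : (f : Fin 3 → ℤ) → ∃ λ (σ : Permutation′ 3) →
        f (σ ⟨$⟩ʳ 0F) ≤ f (σ ⟨$⟩ʳ 1F) × f (σ ⟨$⟩ʳ 1F) ≤ f (σ ⟨$⟩ʳ 2F)
sort3 f with ≤-total (f 0F) (f 1F) | ≤-total (f 1F) (f 2F) | ≤-total (f 0F) (f 2F)
... | inj₁ x≤y | inj₁ y≤z | _        = id , x≤y , y≤z
... | inj₁ x≤y | inj₂ z≤y | inj₁ x≤z = transpose 1F 2F , x≤z , z≤y
... | inj₁ x≤y | inj₂ z≤y | inj₂ z≤x = transpose 1F 2F ∘ₚ transpose 0F 2F , z≤x , x≤y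
... | inj₂ y≤x | inj₁ y≤z | inj₁ x≤z = transpose 0F 1F , y≤x , x≤z
... | inj₂ y≤x | inj₁ y≤z | inj₂ z≤x = transpose 0F 2F ∘ₚ transpose 1F 2F , y≤z , z≤x
... | inj₂ y≤x | inj₂ z≤y | _        = transpose 0F 2F , z≤y , y≤x

≤+negative⇒< : ∀ {u c d} → u < + 0 → c ≤ u + d → c < d
≤+negative⇒< {u} {c} {d} u<0 c≤u+d =
  ≤-<-trans c≤u+d (subst (u + d <_) (+-identityˡ d) (+-mono-<-≤ u<0 (≤-refl {d})))

balanced-sorted⇒isRootOrdered : ∀ {q} → Balanced q → q 0F ≤ + 0 → q 1F ≤ q 2F → q 2F ≤ q 3F →
                                IsRootOrdered (q 0F) (q 1F) (q 2F) (q 3F)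
balanced-sorted⇒isRootOrdered {q} balanced a≤0 b≤c c≤d = a≤0 , 0≤b , b≤c , c≤d , d≤a+b+c
  where
  a = q 0F ; b = q 1F ; c = q 2F ; d = q 3F
  without-c : ∀ a b c d → a + b + c + d - c ≡ a + b + d
  without-c = solve-∀
  without-d : ∀ a b c d → a + b + c + d - d ≡ a + b + c
  without-d = solve-∀
  c≤a+b+d : c ≤ a + b + d
  c≤a+b+d = ≤-trans (balanced 2F) (≤-reflexive (without-c a b c d))
  d≤a+b+c : d ≤ a + b + c
  d≤a+b+c = ≤-trans (balanced 3F) (≤-reflexive (without-d a b c d))
  0≤b : + 0 ≤ b
  0≤b = ≮⇒≥ λ b<0 → let a+b<0 = +-mono-≤-< a≤0 b<0 in
    <-asym (≤+negative⇒< a+b<0 c≤a+b+d) (≤+negative⇒< a+b<0 d≤a+b+c)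

balanced⇒isRoot : ∀ {q} i → Balanced q → q i ≤ + 0 → IsRoot q
balanced⇒isRoot {q} i balanced qi≤0 with sort3 (λ j → q (transpose 0F i ⟨$⟩ʳ Fin.suc j))
... | σ , b≤c , c≤d =
  isRoot-rearrange τ {q} (isRoot-rearrange (lift₀ σ) {q′} (id , balanced-sorted⇒isRootOrdered
    (balanced-rearrange (lift₀ σ) (balanced-rearrange τ balanced)) qi≤0 b≤c c≤d))
  where
  τ = transpose 0F i
  q′ = rearrange (τ ⟨$⟩ʳ_) q

decidedBalanced⇒isRoot : ∀ r i → True (balanced? r) → r i ≤ + 0 → ∀ {q} → q ≗ r → IsRoot q
decidedBalanced⇒isRoot r i decided ri≤0 q≗r =
  isRoot-≗ q≗r (balanced⇒isRoot i (toWitness decided) ri≤0)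

simplest⇒isRoot : ∀ {q} → IsSimplest q → IsRoot q
simplest⇒isRoot (inj₁ q≗) =
  decidedBalanced⇒isRoot (quad (+ 1) (+ 1) (+ 0) (+ 0)) 2F _ ≤-refl q≗
simplest⇒isRoot (inj₂ (inj₁ q≗)) =
  decidedBalanced⇒isRoot (quad (+ 1) (+ 0) (+ 1) (+ 0)) 1F _ ≤-refl q≗
simplest⇒isRoot (inj₂ (inj₂ (inj₁ q≗))) =
  decidedBalanced⇒isRoot (quad (+ 1) (+ 0) (+ 0) (+ 1)) 1F _ ≤-refl q≗
simplest⇒isRoot (inj₂ (inj₂ (inj₂ (inj₁ q≗)))) =
  decidedBalanced⇒isRoot (quad (+ 0) (+ 1) (+ 1) (+ 0)) 0F _ ≤-refl q≗
simplest⇒isRoot (inj₂ (inj₂ (inj₂ (inj₂ (inj₁ q≗))))) =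
  decidedBalanced⇒isRoot (quad (+ 0) (+ 1) (+ 0) (+ 1)) 0F _ ≤-refl q≗
simplest⇒isRoot (inj₂ (inj₂ (inj₂ (inj₂ (inj₂ q≗))))) =
  decidedBalanced⇒isRoot (quad (+ 0) (+ 0) (+ 1) (+ 1)) 0F _ ≤-refl q≗

noSwap⇒balanced : ∀ {q} → ¬ (q 1F + q 2F + q 3F < q 0F) → ¬ (q 0F + q 2F + q 3F < q 1F) →
                  ¬ (q 0F + q 1F + q 3F < q 2F) → ¬ (q 0F + q 1F + q 2F < q 3F) → Balanced q
noSwap⇒balanced {q} n₀ n₁ n₂ n₃ = λ where
    0F → ≤-trans (≮⇒≥ n₀) (≤-reflexive (without-a a b c d))
    1F → ≤-trans (≮⇒≥ n₁) (≤-reflexive (without-b a b c d))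
    2F → ≤-trans (≮⇒≥ n₂) (≤-reflexive (without-c a b c d))
    3F → ≤-trans (≮⇒≥ n₃) (≤-reflexive (without-d a b c d))
  where
  a = q 0F ; b = q 1F ; c = q 2F ; d = q 3F
  without-a : ∀ a b c d → b + c + d ≡ a + b + c + d - a
  without-a = solve-∀
  without-b : ∀ a b c d → a + c + d ≡ a + b + c + d - b
  without-b = solve-∀
  without-c : ∀ a b c d → a + b + d ≡ a + b + c + d - c
  without-c = solve-∀
  without-d : ∀ a b c d → a + b + c ≡ a + b + c + d - d
  without-d = solve-∀

inversion⇒balanced : ∀ q {g} → choose (q 0F) (q 1F) (q 2F) (q 3F) ≡ just g → ¬ IsSwap g →
                     Balanced q × ∃ λ i → q i < + 0
inversion⇒balanced q eq noSwap with q 1F + q 2F + q 3F <? q 0F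
... | yes _ with refl ← eq = ⊥-elim (noSwap tt)
... | no n₀ with q 0F + q 2F + q 3F <? q 1F
... | yes _ with refl ← eq = ⊥-elim (noSwap tt)
... | no n₁ with q 0F + q 1F + q 3F <? q 2F
... | yes _ with refl ← eq = ⊥-elim (noSwap tt)
... | no n₂ with q 0F + q 1F + q 2F <? q 3F
... | yes _ with refl ← eq = ⊥-elim (noSwap tt)
... | no n₃ with q 0F <? + 0
... | yes neg = noSwap⇒balanced n₀ n₁ n₂ n₃ , 0F , neg
... | no _ with q 1F <? + 0
... | yes neg = noSwap⇒balanced n₀ n₁ n₂ n₃ , 1F , neg
... | no _ with q 2F <? + 0
... | yes neg = noSwap⇒balanced n₀ n₁ n₂ n₃ , 2F , neg
... | no _ with q 3F <? + 0
... | yes neg = noSwap⇒balanced n₀ n₁ n₂ n₃ , 3F , neg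
... | no _ with () ← eq

TI-step⇒choose : ∀ q {g q′} → TI-step q ≡ just (g , q′) →
                 choose (q 0F) (q 1F) (q 2F) (q 3F) ≡ just g
TI-step⇒choose q eq with choose (q 0F) (q 1F) (q 2F) (q 3F)
... | just _ with refl ← eq = refl
... | nothing with () ← eq

inversionStep⇒isRoot : ∀ {q g q′} → TI-step q ≡ just (g , q′) → ¬ IsSwap g → IsRoot q
inversionStep⇒isRoot {q} step noSwap with inversion⇒balanced q (TI-step⇒choose q step) noSwap
... | balanced , i , qi<0 = balanced⇒isRoot i balanced (<⇒≤ qi<0)

infixr 5 _∷_
data Trace : Quad → List Gen → Quad → Set where
  []  : ∀ {q} → Trace q [] q
  _∷_ : ∀ {q g q′ ws q″} → TI-step q ≡ just (g , q′) → Trace q′ ws q″ → Trace q (g ∷ ws) q″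

trace-∷ʳ : ∀ {q ws q′ g q″} → Trace q ws q′ → TI-step q′ ≡ just (g , q″) → Trace q (ws ∷ʳ g) q″
trace-∷ʳ []             last = last ∷ []
trace-∷ʳ (step ∷ trace) last = step ∷ trace-∷ʳ trace last

run-suc⁻¹ : ∀ m v {W q} → run (suc m) v ≡ just (W , q) →
            ∃ λ ws → ∃ λ q′ → ∃ λ g →
              run m v ≡ just (ws , q′) × W ≡ ws ∷ʳ g × TI-step q′ ≡ just (g , q)
run-suc⁻¹ m v eq with run m v
... | nothing with () ← eq
... | just (ws , q′) with TI-step q′ in step
...   | nothing with () ← eq
...   | just (g , _) with refl ← eq = ws , q′ , g , refl , refl , step

run-length : ∀ m v {ws q} → run m v ≡ just (ws , q) → length ws ≡ m
run-length zero    v refl = refl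
run-length (suc m) v eq with run-suc⁻¹ m v eq
... | ws , _ , g , eq′ , refl , _ = begin
  length (ws ∷ʳ g)  ≡⟨ length-++ ws ⟩
  length ws ℕ.+ 1   ≡⟨ +-comm (length ws) 1 ⟩
  suc (length ws)   ≡⟨ cong suc (run-length m v eq′) ⟩
  suc m             ∎

run-+ : ∀ k m v {W q} → run (k ℕ.+ m) v ≡ just (W , q) →
        ∃ λ ws → ∃ λ q′ → ∃ λ s → run m v ≡ just (ws , q′) × W ≡ ws ++ s × Trace q′ s q
run-+ zero    m v {W} eq = W , _ , [] , eq , sym (++-identityʳ W) , []
run-+ (suc k) m v eq with run-suc⁻¹ (k ℕ.+ m) v eq
... | _ , _ , g , eq′ , refl , last with run-+ k m v eq′
... | ws , q′ , s , eq″ , refl , trace =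
  ws , q′ , s ∷ʳ g , eq″ , ++-assoc ws s [ g ] , trace-∷ʳ trace last

++-cancel-≡length : ∀ {A : Set} (xs ys : List A) {zs ws} → length xs ≡ length ys →
                    xs ++ zs ≡ ys ++ ws → xs ≡ ys × zs ≡ ws
++-cancel-≡length []       []       _   eq = refl , eq
++-cancel-≡length (x ∷ xs) (y ∷ ys) len eq with refl , eq′ ← ∷-injective eq
  with refl , refl ← ++-cancel-≡length xs ys (suc-injective len) eq′ = refl , refl

run-prefix : ∀ n v P R {q} → run n v ≡ just (P ++ R , q) →
             ∃ λ q′ → run (length P) v ≡ just (P , q′) × Trace q′ R q
run-prefix n v P R eq
  with refl ← trans (sym (run-length n v eq)) (trans (length-++ P) (+-comm (length P) (length R)))
  with ws , q′ , s , eq′ , P++R≡ws++s , trace ← run-+ (length R) (length P) v eq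
  with refl , refl ← ++-cancel-≡length ws P (run-length (length P) v eq′) (sym P++R≡ws++s)
  = q′ , eq′ , trace

stop⇒isRoot : ∀ {q R q′} → (R ≡ [] ⊎ ∃ λ g → ∃ λ R′ → R ≡ g ∷ R′ × ¬ IsSwap g) →
              Trace q R q′ → IsSimplest q′ → IsRoot q
stop⇒isRoot (inj₁ refl)                    []         simplest = simplest⇒isRoot simplest
stop⇒isRoot (inj₂ (_ , _ , refl , noSwap)) (step ∷ _) _        = inversionStep⇒isRoot step noSwap

mainTheorem9 : (v : Quad) → IsDescartes v → IsPrimitive v → + 0 < sumQ v →
    (n : ℕ) (W : List Gen) → IsWord v n W →
    (P R : List Gen) → W ≡ P ++ R → All IsSwap P →
    (R ≡ [] ⊎ ∃ λ g → ∃ λ R′ → R ≡ g ∷ R′ × ¬ IsSwap g) →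
    ∃ λ q → run (length P) v ≡ just (P , q) × IsRoot q
mainTheorem9 v _ _ _ n _ (q , runs , simplest , _) P R refl _ stop
  with q′ , runsP , trace ← run-prefix n v P R runs
  = q′ , runsP , stop⇒isRoot stop trace simplest
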